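{- Let $\mathcal{M}$ be a regular matroid on $E$ represented by a totally unimodular real matrix $M$, $\Lambda=\ker(M)\cap\mathbb{Z}^E$, and $\lambda\in\Lambda$. Then $D_\lambda$ is a strongly connected orientation of $\mathcal{N}_\lambda$; that is, $(\mathcal{N}_\lambda,D_\lambda)\in\mathcal{SC}(\mathcal{M})$.
   Context: $\mathcal{N}_\lambda$ is the sub-matroid of $\mathcal{M}$ with base set $\operatorname{supp}(\lambda)=\{e:\lambda_e\neq0\}$, and $D_\lambda:\operatorname{supp}(\lambda)\to\{ -1,1\}$ is the orientation $D_\lambda(e)=\operatorname{sgn}(\lambda_e)$. For a sub-matroid $\mathcal{N}$ with base set $E'$, an orientation $D:E'\to\{ -1,1\}$ yields the matrix $M_{E'}^D$ (columns $c_e$, $e\in E'$, of $M$, each multiplied by $D(e)$); $D$ is strongly connected if for every $e\in E'$ there is $z_e\in(\mathbb{Z}_{\ge0})^{E'}$ with $e+z_e\in\ker(M_{E'}^D)\cap\mathbb{Z}^{E'}$. $\mathcal{SC}(\mathcal{M})$ is the set of pairs $(\mathcal{N},D)$ with $D$ a strongly connected orientation of the sub-matroid $\mathcal{N}$. -}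

module Defs where

open import Data.Nat using (ℕ; zero; suc)
open import Data.Integer using (ℤ; +_; -_; _+_; _*_; sign; 0ℤ; 1ℤ; -1ℤ)
open import Data.Sign using (Sign) renaming (+ to s+; - to s-)
open import Data.Fin using (Fin; zero; suc; punchIn; _≟_)
open import Data.Fin.Subset using (Subset; _∈_)
open import Data.Fin.Subset.Properties using (_∈?_)
open import Data.Vec using (tabulate)
open import Data.Bool using (Bool; not)
open import Data.Product using (Σ; Σ-syntax; ∃-syntax; _×_; _,_)
open import Data.Sum using (_⊎_)
open import Relation.Nullary using (yes; no; ¬_; does)
open import Relation.Binary.PropositionalEquality using (_≡_)
open import Function.Definitions using (Injective)
import Data.Integer.Properties as ℤP

-- Real-valued matrices that are totally unimodular have all entries in
-- {-1,0,1}; we therefore represent M as an integer m × n matrix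
-- (rows = Fin m, ground set E = Fin n).
Matrix : ℕ → ℕ → Set
Matrix m n = Fin m → Fin n → ℤ

∑ : ∀ {k} → (Fin k → ℤ) → ℤ
∑ {zero}  f = 0ℤ
∑ {suc k} f = f zero + ∑ (λ i → f (suc i))

det : ∀ k → (Fin k → Fin k → ℤ) → ℤ
det zero    A = 1ℤ
det (suc k) A = ∑ (λ j → alt j * (A zero j * det k (λ r c → A (suc r) (punchIn j c))))
  where
  alt : ∀ {l} → Fin l → ℤ
  alt zero    = 1ℤ
  alt (suc j) = - alt j

TotallyUnimodular : ∀ {m n} → Matrix m n → Set
TotallyUnimodular {m} {n} M =
  ∀ k (r : Fin k → Fin m) (c : Fin k → Fin n) →
  Injective _≡_ _≡_ r → Injective _≡_ _≡_ c →
  let d = det k (λ i j → M (r i) (c j)) in (d ≡ -1ℤ) ⊎ (d ≡ 0ℤ) ⊎ (d ≡ 1ℤ)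

InΛ : ∀ {m n} → Matrix m n → (Fin n → ℤ) → Set
InΛ M x = ∀ i → ∑ (λ j → M i j * x j) ≡ 0ℤ

-- A sub-matroid is determined by its base set E' ⊆ E (restriction of M to E').
-- Vectors indexed by E' are functions on elements of E'.
VecOn : ∀ {n} → Subset n → Set
VecOn {n} S = (e : Fin n) → e ∈ S → ℤ

Orientation : ∀ {n} → Subset n → Set
Orientation {n} S = (e : Fin n) → e ∈ S → Sign

signℤ : Sign → ℤ
signℤ s+ = 1ℤ
signℤ s- = -1ℤ

∑on : ∀ {n} (S : Subset n) → ((e : Fin n) → e ∈ S → ℤ) → ℤ
∑on S f = ∑ (λ e → h e (e ∈? S))
  where
  open import Relation.Nullary using (Dec)
  h : ∀ e → Dec (e ∈ S) → ℤ
  h e (yes p) = f e p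
  h e (no _)  = 0ℤ

InKerOriented : ∀ {m n} → Matrix m n → (S : Subset n) → Orientation S → VecOn S → Set
InKerOriented M S D x = ∀ i → ∑on S (λ e p → (M i e * signℤ (D e p)) * x e p) ≡ 0ℤ

unitPlus : ∀ {n} (S : Subset n) → Fin n → ((e : Fin n) → e ∈ S → ℕ) → VecOn S
unitPlus S e z e' p with e' ≟ e
... | yes _ = 1ℤ + + z e' p
... | no _  = + z e' p

StronglyConnected : ∀ {m n} → Matrix m n → (S : Subset n) → Orientation S → Set
StronglyConnected M S D =
  ∀ e (p : e ∈ S) → Σ[ z ∈ ((e' : _) → e' ∈ S → ℕ) ] InKerOriented M S D (unitPlus S e z)

SC : ∀ {m n} → Matrix m n → Σ[ S ∈ Subset _ ] Orientation S → Set
SC M (S , D) = StronglyConnected M S D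

supp : ∀ {n} → (Fin n → ℤ) → Subset n
supp x = tabulate (λ e → not (does (x e ℤP.≟ 0ℤ)))

Dλ : ∀ {n} (x : Fin n → ℤ) → Orientation (supp x)
Dλ x e _ = sign (x e)

{-# OPTIONS --safe #-}
-- With z := |λ| − 1_e (nonnegative since λ_e ≠ 0), the vector 1_e + z is |λ| restricted to
-- supp λ, and reorienting column c_f by sgn λ_f turns |λ_f| back into λ_f. Hence
-- M^{D_λ}(1_e + z) = M λ = 0.
module Submission where

open import Defs
open import Data.Nat using (ℕ; zero; suc; _∸_)
open import Data.Integer using (ℤ; +_; -[1+_]; _+_; _*_; ∣_∣; sign; 0ℤ; 1ℤ)
import Data.Integer.Properties as ℤP
open import Data.Fin using (Fin; zero; suc; _≟_)
open import Data.Fin.Subset using (Subset; _∈_; _∉_)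
open import Data.Fin.Subset.Properties using (_∈?_)
open import Data.Vec using (lookup)
open import Data.Vec.Properties using ([]=⇒lookup; lookup⇒[]=; lookup∘tabulate)
open import Data.Bool using (not)
open import Data.Product using (_,_)
open import Relation.Nullary using (yes; no; does)
open import Relation.Binary.PropositionalEquality
open import Data.Empty using (⊥-elim)

∑-cong : ∀ {k} {f g : Fin k → ℤ} → (∀ i → f i ≡ g i) → ∑ f ≡ ∑ g
∑-cong {zero}  f≗g = refl
∑-cong {suc k} f≗g = cong₂ _+_ (f≗g zero) (∑-cong (λ i → f≗g (suc i)))

mutual
  ∑on≡∑ : ∀ {n} (S : Subset n) {f : (e : Fin n) → e ∈ S → ℤ} {g : Fin n → ℤ} →
          (∀ e p → f e p ≡ g e) → (∀ e → e ∉ S → g e ≡ 0ℤ) → ∑on S f ≡ ∑ g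
  ∑on≡∑ S on off = ∑-cong (∑on-entry≡ S on off)

  -- The type of an entry of ∑on mentions a function local to its definition, so it is
  -- left to be inferred from the use above.
  ∑on-entry≡ : ∀ {n} (S : Subset n) {f : (e : Fin n) → e ∈ S → ℤ} {g : Fin n → ℤ} →
               (∀ e p → f e p ≡ g e) → (∀ e → e ∉ S → g e ≡ 0ℤ) → ∀ e → _
  ∑on-entry≡ S on off e with e ∈? S
  ... | yes p = on e p
  ... | no ¬p = sym (off e ¬p)

lookup-supp : ∀ {n} (x : Fin n → ℤ) e → lookup (supp x) e ≡ not (does (x e ℤP.≟ 0ℤ))
lookup-supp x e = lookup∘tabulate (λ e → not (does (x e ℤP.≟ 0ℤ))) e

∈supp⇒≢0 : ∀ {n} (x : Fin n → ℤ) {e} → e ∈ supp x → x e ≢ 0ℤ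
∈supp⇒≢0 x {e} e∈ with x e ℤP.≟ 0ℤ | trans (sym (lookup-supp x e)) ([]=⇒lookup e∈)
... | no x≢0 | _ = x≢0
... | yes _  | ()

∉supp⇒≡0 : ∀ {n} (x : Fin n → ℤ) {e} → e ∉ supp x → x e ≡ 0ℤ
∉supp⇒≡0 x {e} e∉ with x e ℤP.≟ 0ℤ in eq
... | yes x≡0 = x≡0
... | no _    = ⊥-elim (e∉ (lookup⇒[]= e _ (trans (lookup-supp x e) (cong (λ d → not (does d)) eq))))

signℤ-sign-*-∣∣ : ∀ x → signℤ (sign x) * + ∣ x ∣ ≡ x
signℤ-sign-*-∣∣ (+ zero)  = refl
signℤ-sign-*-∣∣ (+ suc n) = ℤP.*-identityˡ (+ suc n)
signℤ-sign-*-∣∣ -[1+ n ]  = ℤP.-1*i≡-i (+ suc n)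

decrementAt : ∀ {n} → Fin n → (Fin n → ℕ) → Fin n → ℕ
decrementAt e w f with f ≟ e
... | yes _ = w f ∸ 1
... | no _  = w f

1+[k∸1]≡k : ∀ {k} → k ≢ 0 → 1ℤ + + (k ∸ 1) ≡ + k
1+[k∸1]≡k {zero}  k≢0 = ⊥-elim (k≢0 refl)
1+[k∸1]≡k {suc k} _   = refl

unitPlus-decrementAt : ∀ {n} (S : Subset n) e (w : Fin n → ℕ) → w e ≢ 0 →
                       ∀ f p → unitPlus S e (λ f _ → decrementAt e w f) f p ≡ + w f
unitPlus-decrementAt S e w we≢0 f p with f ≟ e in f≟e
... | yes refl rewrite f≟e = 1+[k∸1]≡k we≢0
... | no _     rewrite f≟e = refl

orientedRow-∣x∣ : ∀ {m n} (M : Matrix m n) (x : Fin n → ℤ) (y : VecOn (supp x)) →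
                  (∀ f p → y f p ≡ + ∣ x f ∣) →
                  ∀ i → ∑on (supp x) (λ f p → (M i f * signℤ (Dλ x f p)) * y f p) ≡ ∑ (λ f → M i f * x f)
orientedRow-∣x∣ M x y y≡∣x∣ i = ∑on≡∑ (supp x) on off
  where
  open ≡-Reasoning
  on : ∀ f p → (M i f * signℤ (Dλ x f p)) * y f p ≡ M i f * x f
  on f p = begin
    (M i f * signℤ (sign (x f))) * y f p      ≡⟨ cong ((M i f * signℤ (sign (x f))) *_) (y≡∣x∣ f p) ⟩
    (M i f * signℤ (sign (x f))) * + ∣ x f ∣  ≡⟨ ℤP.*-assoc (M i f) _ _ ⟩
    M i f * (signℤ (sign (x f)) * + ∣ x f ∣)  ≡⟨ cong (M i f *_) (signℤ-sign-*-∣∣ (x f)) ⟩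
    M i f * x f                               ∎
  off : ∀ f → f ∉ supp x → M i f * x f ≡ 0ℤ
  off f f∉ = trans (cong (M i f *_) (∉supp⇒≡0 x f∉)) (ℤP.*-zeroʳ (M i f))

lemma4p14 : ∀ {m n} (M : Matrix m n) → TotallyUnimodular M →
    (λv : Fin n → ℤ) → InΛ M λv →
    SC M (supp λv , Dλ λv)
lemma4p14 M _ x Mx≡0 e e∈ = z , λ i → trans (orientedRow-∣x∣ M x (unitPlus (supp x) e z) 1ₑ+z≡∣x∣ i) (Mx≡0 i)
  where
  ∣x∣ : _ → ℕ
  ∣x∣ f = ∣ x f ∣
  z : (f : _) → f ∈ supp x → ℕ
  z f _ = decrementAt e ∣x∣ f
  1ₑ+z≡∣x∣ : ∀ f p → unitPlus (supp x) e z f p ≡ + ∣ x f ∣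
  1ₑ+z≡∣x∣ = unitPlus-decrementAt (supp x) e ∣x∣ (λ ∣xe∣≡0 → ∈supp⇒≢0 x e∈ (ℤP.∣i∣≡0⇒i≡0 ∣xe∣≡0))
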